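{- For every even positive integer $k$ there exists a stacked triangulation $G_k$ with $n = (7k+4)/2$ vertices such that every edge guard set of $G_k$ has at least $k = (2n-4)/7$ edges.
   Context: A plane graph is a simple graph together with a crossing-free embedding in $\mathbb{R}^2$. Stacked triangulations are defined recursively: (i) a triangle (a plane $3$-cycle) is a stacked triangulation; (ii) if $G$ is a stacked triangulation and $f=(x,y,z)$ is an inner face, then the plane graph obtained by placing a new vertex $v$ inside $f$ and joining it to $x,y,z$ is a stacked triangulation. For a plane graph $G=(V,E)$, a face $f$ is guarded by an edge $vw \in E$ if at least one of $v,w$ lies on the boundary of $f$. A set $\Gamma \subseteq E$ is an edge guard set if every face of $G$ (including the outer face) is guarded by some edge of $\Gamma$. -}

module Defs where

open import Data.Nat using (ℕ; suc; _+_; _*_; _≤_; _>_)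
open import Data.Product using (_×_; _,_; Σ; ∃-syntax)
open import Data.Sum using (_⊎_)
open import Data.List using (List; []; _∷_; _++_; length)
open import Data.List.Membership.Propositional using (_∈_)
open import Data.List.Relation.Unary.All using (All)
open import Data.List.Relation.Unary.Any using (Any)
open import Data.List.Relation.Unary.Unique.Propositional using (Unique)
open import Relation.Binary.PropositionalEquality using (_≡_)

-- Vertices are natural numbers; a stacked triangulation on n vertices uses
-- the vertices 0,1,…,n-1.  A triangular face is given by its three boundary
-- vertices, an edge by its two endpoints.
Vertex : Set
Vertex = ℕ

Face : Set
Face = Vertex × Vertex × Vertex

Edge : Set
Edge = Vertex × Vertex

-- Stacked n fs es : the (combinatorial) plane graph with vertex set {0..n-1},
-- list of inner faces fs and edge list es is a stacked triangulation.
-- The outer face is always bounded by the initial triangle 0,1,2.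
-- Stacking into the inner face (x,y,z) adds the new vertex n, edges xn,yn,zn,
-- and replaces the face (x,y,z) by the three faces (x,y,n),(y,z,n),(z,x,n).
data Stacked : ℕ → List Face → List Edge → Set where
  triangle : Stacked 3 ((0 , 1 , 2) ∷ []) ((0 , 1) ∷ (1 , 2) ∷ (0 , 2) ∷ [])
  stack    : ∀ {n pre post es x y z} →
             Stacked n (pre ++ (x , y , z) ∷ post) es →
             Stacked (suc n)
               ((x , y , n) ∷ (y , z , n) ∷ (z , x , n) ∷ (pre ++ post))
               ((x , n) ∷ (y , n) ∷ (z , n) ∷ es)

outerFace : Face
outerFace = (0 , 1 , 2)

OnBoundary : Vertex → Face → Set
OnBoundary v (a , b , c) = v ≡ a ⊎ v ≡ b ⊎ v ≡ c

GuardedBy : Face → Edge → Set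
GuardedBy f (v , w) = OnBoundary v f ⊎ OnBoundary w f

-- Γ (a duplicate-free list, i.e. a finite set, of edges) is an edge guard set
-- of the plane graph with inner faces fs and edges es: Γ ⊆ E and every face,
-- inner ones and the outer face, is guarded by some edge of Γ.
IsEdgeGuardSet : List Face → List Edge → List Edge → Set
IsEdgeGuardSet fs es Γ =
  Unique Γ ×
  All (_∈ es) Γ ×
  All (λ f → Any (GuardedBy f) Γ) (outerFace ∷ fs)

module Submission where

-- Colour some vertices with natural numbers, i.e. fix a partial
-- colouring χ : Vertex → Maybe ℕ.  If no edge joins two vertices of different
-- colours and, for every colour i < k, some face has all three vertices of
-- colour i, then every edge guard set has at least k edges: an edge guarding a
-- face of colour i has an endpoint of colour i, so the colour of its first
-- coloured endpoint is i, and the edges of a guard set realise all k colours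
-- (pigeonhole).
--
-- The graph for k = 2(J+1) is built by stacking.  A gadget stacks three new
-- vertices into a face so that they span a new inner triangle.  A block stacks
-- a vertex s into an uncoloured face (a,b,c) and places gadgets into (a,b,s)
-- and (b,c,s), leaving the uncoloured face (c,a,s) for the next block.  We
-- start from the outer triangle (colour 0) with an uncoloured gadget 3,4,5
-- inside it, add J blocks (colours 1,…,2J) and a final gadget (colour 2J+1):
-- 6 + 7J + 3 = (7k+4)/2 vertices.

open import Defs
open import Data.Nat using (ℕ; zero; suc; _+_; _*_; _≤_; _<_; _>_; _≤?_; s≤s)
open import Data.Nat.Properties using (+-suc; +-comm; +-identityʳ; <-irrefl; ≰⇒>; m<1+n⇒m<n∨m≡n)
open import Data.Nat.Solver using (module +-*-Solver)
open import Data.Fin using (Fin; toℕ)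
open import Data.Fin.Properties using (pigeonhole; toℕ<n)
open import Data.Maybe using (Maybe; just; nothing; _<∣>_)
import Data.Maybe as Maybe
open import Data.Maybe.Properties using (just-injective)
open import Data.Unit using (⊤; tt)
open import Data.Empty using (⊥-elim)
open import Data.Product using (_×_; _,_; ∃-syntax)
open import Data.Sum using (_⊎_; inj₁; inj₂)
import Data.Sum as Sum
open import Data.List using (List; []; _∷_; _++_; length; map; lookup)
open import Data.List.Properties using (length-map)
open import Data.List.Membership.Propositional using (_∈_; find)
open import Data.List.Membership.Propositional.Properties using (∈-∃++; ∈-++⁺ʳ; ∈-map⁺)
open import Data.List.Relation.Unary.All as All using (All; []; _∷_)
open import Data.List.Relation.Unary.All.Properties using (++⁺)
open import Data.List.Relation.Unary.Any as Any using (here; there)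
open import Data.List.Relation.Unary.Any.Properties using (lookup-index)
open import Relation.Binary.PropositionalEquality using (_≡_; refl; sym; trans; cong; subst)
open import Relation.Nullary using (¬_; yes; no)

-- A list containing the values of an injective family at 0,…,k-1 has at least
-- k entries: otherwise two of these values would sit at the same position.
length-≥-injective : ∀ {A : Set} (a : ℕ → A) → (∀ {i j} → a i ≡ a j → i ≡ j) →
  ∀ k (L : List A) → (∀ i → i < k → a i ∈ L) → k ≤ length L
length-≥-injective a a-injective k L member with k ≤? length L
... | yes k≤length = k≤length
... | no k≰length =
  let i , j , i<j , samePosition = pigeonhole (≰⇒> k≰length) position
  in ⊥-elim (<-irrefl (a-injective (trans (valueAt i)
       (trans (cong (lookup L) samePosition) (sym (valueAt j))))) i<j)
  where
  position : Fin k → Fin (length L)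
  position i = Any.index (member (toℕ i) (toℕ<n i))
  valueAt : ∀ i → a (toℕ i) ≡ lookup L (position i)
  valueAt i = lookup-index (member (toℕ i) (toℕ<n i))

Colouring : Set
Colouring = Vertex → Maybe ℕ

Compatible : Maybe ℕ → Maybe ℕ → Set
Compatible (just i) (just j) = i ≡ j
Compatible _        _        = ⊤

Proper : Colouring → Edge → Set
Proper χ (x , y) = Compatible (χ x) (χ y)

Monochromatic : Colouring → ℕ → Face → Set
Monochromatic χ i (a , b , c) = χ a ≡ just i × χ b ≡ just i × χ c ≡ just i

Colourless : Colouring → Face → Set
Colourless χ (a , b , c) = χ a ≡ nothing × χ b ≡ nothing × χ c ≡ nothing

edgeColour : Colouring → Edge → Maybe ℕ
edgeColour χ (x , y) = χ x <∣> χ y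

boundaryColour : ∀ χ {i v f} → Monochromatic χ i f → OnBoundary v f → χ v ≡ just i
boundaryColour χ (χa , _ , _) (inj₁ refl) = χa
boundaryColour χ (_ , χb , _) (inj₂ (inj₁ refl)) = χb
boundaryColour χ (_ , _ , χc) (inj₂ (inj₂ refl)) = χc

first-compatible : ∀ {i} (o p : Maybe ℕ) → Compatible o p →
  o ≡ just i ⊎ p ≡ just i → (o <∣> p) ≡ just i
first-compatible (just j) p        _   (inj₁ o≡i) = o≡i
first-compatible (just j) (just l) j≡l (inj₂ refl) = cong just j≡l
first-compatible nothing  p        _   (inj₂ p≡i) = p≡i

guardColour : ∀ χ {i f e} → Proper χ e → GuardedBy f e → Monochromatic χ i f →
  edgeColour χ e ≡ just i
guardColour χ {e = x , y} proper guards mono =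
  first-compatible (χ x) (χ y) proper
    (Sum.map (boundaryColour χ mono) (boundaryColour χ mono) guards)

Witnessed : Colouring → List Face → ℕ → Set
Witnessed χ fs k = ∀ i → i < k → ∃[ f ] (f ∈ outerFace ∷ fs × Monochromatic χ i f)

guardLowerBound : ∀ χ {fs es k} → All (Proper χ) es → Witnessed χ fs k →
  (Γ : List Edge) → IsEdgeGuardSet fs es Γ → k ≤ length Γ
guardLowerBound χ {k = k} proper witnessed Γ (_ , Γ⊆es , guarded) =
  subst (k ≤_) (length-map (edgeColour χ) Γ)
    (length-≥-injective just just-injective k (map (edgeColour χ) Γ) colourUsed)
  where
  colourUsed : ∀ i → i < k → just i ∈ map (edgeColour χ) Γ
  colourUsed i i<k with witnessed i i<k
  ... | f , f∈ , mono with find (All.lookup guarded f∈)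
  ... | e , e∈Γ , guards =
    subst (_∈ map (edgeColour χ) Γ)
      (guardColour χ (All.lookup proper (All.lookup Γ⊆es e∈Γ)) guards mono)
      (∈-map⁺ (edgeColour χ) e∈Γ)

proper-colourless : ∀ χ {x} y → χ x ≡ nothing → Proper χ (x , y)
proper-colourless χ y χx rewrite χx = tt

proper-same : ∀ χ {x y i} → χ x ≡ just i → χ y ≡ just i → Proper χ (x , y)
proper-same χ χx χy rewrite χx | χy = refl

∈-remove : ∀ {A : Set} {x y : A} xs ys → x ∈ xs ++ y ∷ ys → ¬ x ≡ y → x ∈ xs ++ ys
∈-remove []       ys (here x≡y) x≢y = ⊥-elim (x≢y x≡y)
∈-remove []       ys (there x∈) x≢y = x∈
∈-remove (z ∷ xs) ys (here x≡z) x≢y = here x≡z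
∈-remove (z ∷ xs) ys (there x∈) x≢y = there (∈-remove xs ys x∈ x≢y)

mono≢colourless : ∀ χ {i f g} → Monochromatic χ i f → Colourless χ g → ¬ f ≡ g
mono≢colourless χ (χa , _) (χa' , _) refl with trans (sym χa) χa'
... | ()

witnessed-remove : ∀ χ {W k} pre post → Colourless χ W →
  Witnessed χ (pre ++ W ∷ post) k → Witnessed χ (pre ++ post) k
witnessed-remove χ pre post blank witnessed i i<k with witnessed i i<k
... | f , here refl , mono = f , here refl , mono
... | f , there f∈ , mono =
  f , there (∈-remove pre post f∈ (mono≢colourless χ mono blank)) , mono

witnessed-++ : ∀ χ {fs k} gs → Witnessed χ fs k → Witnessed χ (gs ++ fs) k
witnessed-++ χ gs witnessed i i<k with witnessed i i<k
... | f , here refl , mono = f , here refl , mono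
... | f , there f∈ , mono = f , there (∈-++⁺ʳ gs f∈) , mono

witnessed-extend : ∀ χ {fs k f} → Witnessed χ fs k → f ∈ fs →
  Monochromatic χ k f → Witnessed χ fs (suc k)
witnessed-extend χ witnessed f∈ mono i i<1+k with m<1+n⇒m<n∨m≡n i<1+k
... | inj₁ i<k  = witnessed i i<k
... | inj₂ refl = _ , there f∈ , mono

-- A gadget in the face (a,b,c): stack n into (a,b,c), n+1 into (a,b,n) and
-- n+2 into (b,n,n+1); the core (n,n+1,n+2) is a face spanned by new vertices.
gadgetCore : Vertex → Face
gadgetCore n = (n , suc n , suc (suc n))

gadgetFaces : Vertex → Vertex → Vertex → Vertex → List Face
gadgetFaces a b c n =
  (b , n , suc (suc n)) ∷ gadgetCore n ∷ (suc n , b , suc (suc n)) ∷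
  (a , b , suc n) ∷ (n , a , suc n) ∷ (b , c , n) ∷ (c , a , n) ∷ []

gadgetEdges : Vertex → Vertex → Vertex → Vertex → List Edge
gadgetEdges a b c n =
  (b , suc (suc n)) ∷ (n , suc (suc n)) ∷ (suc n , suc (suc n)) ∷
  (a , suc n) ∷ (b , suc n) ∷ (n , suc n) ∷ (a , n) ∷ (b , n) ∷ (c , n) ∷ []

gadgetCore∈ : ∀ a b c n rest → gadgetCore n ∈ gadgetFaces a b c n ++ rest
gadgetCore∈ a b c n rest = there (here refl)

gadgetStacked : ∀ {n es} pre post {a b c} → Stacked n (pre ++ (a , b , c) ∷ post) es →
  Stacked (3 + n) (gadgetFaces a b c n ++ (pre ++ post)) (gadgetEdges a b c n ++ es)
gadgetStacked pre post st =
  stack {pre = (_ , _ , _) ∷ []} (stack {pre = []} (stack {pre = pre} {post = post} st))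

gadgetProper : ∀ χ {a b c n i} → Colourless χ (a , b , c) →
  Monochromatic χ i (gadgetCore n) → All (Proper χ) (gadgetEdges a b c n)
gadgetProper χ (χa , χb , χc) (χn , χn₁ , χn₂) =
  proper-colourless χ _ χb ∷ proper-same χ χn χn₂ ∷ proper-same χ χn₁ χn₂ ∷
  proper-colourless χ _ χa ∷ proper-colourless χ _ χb ∷ proper-same χ χn χn₁ ∷
  proper-colourless χ _ χa ∷ proper-colourless χ _ χb ∷ proper-colourless χ _ χc ∷ []

gadgetWitnessed : ∀ χ {W k a b c n} pre post → Colourless χ W →
  Witnessed χ (pre ++ W ∷ post) k → Monochromatic χ k (gadgetCore n) →
  Witnessed χ (gadgetFaces a b c n ++ (pre ++ post)) (suc k)
gadgetWitnessed χ {a = a} {b} {c} {n} pre post blank witnessed core =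
  witnessed-extend χ
    (witnessed-++ χ (gadgetFaces a b c n) (witnessed-remove χ pre post blank witnessed))
    (gadgetCore∈ a b c n (pre ++ post)) core

-- A block in the face (a,b,c): stack s into it, then gadgets into (a,b,s) and
-- (b,c,s); it uses the seven vertices s,…,s+6 and leaves the face (c,a,s).
blockFaces : Vertex → Vertex → Vertex → Vertex → List Face
blockFaces a b c s =
  gadgetFaces b c s (4 + s) ++ gadgetFaces a b s (1 + s) ++ (c , a , s) ∷ []

blockEdges : Vertex → Vertex → Vertex → Vertex → List Edge
blockEdges a b c s =
  gadgetEdges b c s (4 + s) ++ gadgetEdges a b s (1 + s) ++ (a , s) ∷ (b , s) ∷ (c , s) ∷ []

blockStacked : ∀ {s es} pre post {a b c} → Stacked s (pre ++ (a , b , c) ∷ post) es →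
  Stacked (7 + s) (blockFaces a b c s ++ (pre ++ post)) (blockEdges a b c s ++ es)
blockStacked {s} pre post {a} {b} {c} st =
  gadgetStacked (gadgetFaces a b s (1 + s)) ((c , a , s) ∷ pre ++ post)
    (gadgetStacked [] ((b , c , s) ∷ (c , a , s) ∷ pre ++ post)
      (stack {pre = pre} {post = post} st))

blockProper : ∀ χ {a b c s i j} → Colourless χ (a , b , c) → χ s ≡ nothing →
  Monochromatic χ i (gadgetCore (1 + s)) → Monochromatic χ j (gadgetCore (4 + s)) →
  All (Proper χ) (blockEdges a b c s)
blockProper χ (χa , χb , χc) χs core₁ core₂ =
  ++⁺ (gadgetProper χ (χb , χc , χs) core₂)
    (++⁺ (gadgetProper χ (χa , χb , χs) core₁)
      (proper-colourless χ _ χa ∷ proper-colourless χ _ χb ∷ proper-colourless χ _ χc ∷ []))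

blockWitnessed : ∀ χ {W k a b c s} pre post → Colourless χ W →
  Witnessed χ (pre ++ W ∷ post) k →
  Monochromatic χ k (gadgetCore (1 + s)) → Monochromatic χ (suc k) (gadgetCore (4 + s)) →
  Witnessed χ (blockFaces a b c s ++ (pre ++ post)) (2 + k)
blockWitnessed χ {a = a} {b} {c} {s} pre post blank witnessed core₁ core₂ =
  witnessed-extend χ
    (witnessed-extend χ
      (witnessed-++ χ (blockFaces a b c s) (witnessed-remove χ pre post blank witnessed))
      (∈-++⁺ʳ (gadgetFaces b c s (4 + s)) (gadgetCore∈ a b s (1 + s) _)) core₁)
    (gadgetCore∈ b c s (4 + s) _) core₂

-- Vertex 6 + t gets laterColour J t: block q < J
-- occupies 6+7q,…,12+7q, coloured  ∅, 2q+1 (three times), 2q+2 (three times),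
-- and the final gadget 6+7J, 7+7J, 8+7J gets colour 2J+1.
laterColour : ℕ → ℕ → Maybe ℕ
laterColour zero    0 = just 1
laterColour zero    1 = just 1
laterColour zero    2 = just 1
laterColour zero    _ = nothing
laterColour (suc J) 0 = nothing
laterColour (suc J) 1 = just 1
laterColour (suc J) 2 = just 1
laterColour (suc J) 3 = just 1
laterColour (suc J) 4 = just 2
laterColour (suc J) 5 = just 2
laterColour (suc J) 6 = just 2
laterColour (suc J) (suc (suc (suc (suc (suc (suc (suc t))))))) =
  Maybe.map (2 +_) (laterColour J t)

colour : ℕ → Colouring
colour J 0 = just 0
colour J 1 = just 0
colour J 2 = just 0
colour J 3 = nothing
colour J 4 = nothing
colour J 5 = nothing
colour J (suc (suc (suc (suc (suc (suc t)))))) = laterColour J t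

laterColour-shift : ∀ q D t →
  laterColour (q + D) (q * 7 + t) ≡ Maybe.map (_+ q * 2) (laterColour D t)
laterColour-shift zero D t with laterColour D t
... | nothing = refl
... | just x  = cong just (sym (+-identityʳ x))
laterColour-shift (suc q) D t rewrite laterColour-shift q D t with laterColour D t
... | nothing = refl
... | just x  = cong just (sym (trans (+-suc x (suc (q * 2))) (cong suc (+-suc x (q * 2)))))

colour-after : ∀ {J} q D → q + D ≡ J → ∀ r →
  colour J (6 + (r + q * 7)) ≡ Maybe.map (_+ q * 2) (laterColour D r)
colour-after q D refl r rewrite +-comm r (q * 7) = laterColour-shift q D r

record Stage (J q : ℕ) : Set where
  constructor stage
  field
    faces           : List Face
    edges           : List Edge
    stacked         : Stacked (6 + q * 7) faces edges
    proper          : All (Proper (colour J)) edges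
    witnessed       : Witnessed (colour J) faces (suc (q * 2))
    blank           : Face
    blank∈          : blank ∈ faces
    blankColourless : Colourless (colour J) blank

-- The uncoloured gadget 3,4,5 inside the outer triangle; its edges are
-- proper since each has an uncoloured endpoint or lies on the outer triangle.
initialStage : ∀ J → Stage J 0
initialStage J =
  stage _ _ (gadgetStacked [] [] triangle)
    (tt ∷ tt ∷ tt ∷ tt ∷ tt ∷ tt ∷ tt ∷ tt ∷ tt ∷ refl ∷ refl ∷ refl ∷ [])
    outerWitness (3 , 4 , 5) (gadgetCore∈ 0 1 2 3 []) (refl , refl , refl)
  where
  outerWitness : Witnessed (colour J) (gadgetFaces 0 1 2 3 ++ []) 1
  outerWitness zero    _           = outerFace , here refl , refl , refl , refl
  outerWitness (suc i) (s≤s ())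

nextStage : ∀ {J} q D → q + suc D ≡ J → Stage J q → Stage J (suc q)
nextStage {J} q D q+1+D≡J (stage _ es st proper witnessed (a , b , c) W∈ Wc@(χa , _ , χc))
  with ∈-∃++ W∈
... | pre , post , refl =
  stage (blockFaces a b c s ++ (pre ++ post)) (blockEdges a b c s ++ es)
    (blockStacked pre post st)
    (++⁺ (blockProper χ Wc (χ≡ 0) core₁ core₂) proper)
    (blockWitnessed χ pre post Wc witnessed core₁ core₂)
    (c , a , s)
    (∈-++⁺ʳ (gadgetFaces b c s (4 + s)) (∈-++⁺ʳ (gadgetFaces a b s (1 + s)) (here refl)))
    (χc , χa , χ≡ 0)
  where
  χ : Colouring
  χ = colour J
  s : Vertex
  s = 6 + q * 7
  χ≡ : ∀ r → χ (6 + (r + q * 7)) ≡ Maybe.map (_+ q * 2) (laterColour (suc D) r)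
  χ≡ = colour-after q (suc D) q+1+D≡J
  core₁ : Monochromatic χ (1 + q * 2) (gadgetCore (1 + s))
  core₁ = χ≡ 1 , χ≡ 2 , χ≡ 3
  core₂ : Monochromatic χ (2 + q * 2) (gadgetCore (4 + s))
  core₂ = χ≡ 4 , χ≡ 5 , χ≡ 6

lastStage : ∀ {J} q D → q + D ≡ J → Stage J q → Stage J J
lastStage q zero    q+0≡J S = subst (Stage _) (trans (sym (+-identityʳ q)) q+0≡J) S
lastStage q (suc D) q+1+D≡J S =
  lastStage (suc q) D (trans (sym (+-suc q D)) q+1+D≡J) (nextStage q D q+1+D≡J S)

colourCount : ∀ J → 2 + J * 2 ≡ 2 * suc J
colourCount = solve 1 (λ j → con 2 :+ j :* con 2 := con 2 :* (con 1 :+ j)) refl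
  where open +-*-Solver

vertexCount : ∀ J → 2 * (9 + J * 7) ≡ 7 * (2 * suc J) + 4
vertexCount = solve 1 (λ j → con 2 :* (con 9 :+ j :* con 7) := con 7 :* (con 2 :* (con 1 :+ j)) :+ con 4) refl
  where open +-*-Solver

lowerBoundGraph : ∀ J → ∃[ fs ] ∃[ es ] (Stacked (9 + J * 7) fs es ×
  ((Γ : List Edge) → IsEdgeGuardSet fs es Γ → 2 * suc J ≤ length Γ))
lowerBoundGraph J with lastStage 0 J refl (initialStage J)
... | stage _ _ st proper witnessed _ W∈ Wc with ∈-∃++ W∈
... | pre , post , refl =
  _ , _ , gadgetStacked pre post st ,
  guardLowerBound χ (++⁺ (gadgetProper χ Wc core) proper)
    (subst (Witnessed χ _) (colourCount J) (gadgetWitnessed χ pre post Wc witnessed core))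
  where
  χ : Colouring
  χ = colour J
  χ≡ : ∀ r → χ (6 + (r + J * 7)) ≡ Maybe.map (_+ J * 2) (laterColour 0 r)
  χ≡ = colour-after J 0 (+-identityʳ J)
  core : Monochromatic χ (1 + J * 2) (gadgetCore (6 + J * 7))
  core = χ≡ 0 , χ≡ 1 , χ≡ 2

theorem4 : (k : ℕ) → k > 0 → (∃[ m ] k ≡ 2 * m) →
    ∃[ n ] (2 * n ≡ 7 * k + 4 ×
      ∃[ fs ] ∃[ es ] (Stacked n fs es ×
        ((Γ : List Edge) → IsEdgeGuardSet fs es Γ → k ≤ length Γ)))
theorem4 .(2 * zero)  ()  (zero  , refl)
theorem4 .(2 * suc J) _   (suc J , refl) = 9 + J * 7 , vertexCount J , lowerBoundGraph J
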